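{- For all integers $n\ge r\ge1$, the number $h_{n,r}$ of run-sorted permutations of $[n]$ having exactly $r$ right-to-left minima equals $S(n-1,r-1)$, the Stirling number of the second kind (the number of set partitions of $[n-1]$ into $r-1$ blocks, with $S(0,0)=1$).
   Context: A permutation of $[n]$ is run-sorted if it is the concatenation of the blocks of a set partition of $[n]$ in block representation (elements of each block increasing, blocks ordered by increasing minima); equivalently, the minima of its successive runs (maximal increasing factors) are increasing. A right-to-left minimum of $\pi=\pi_1\cdots\pi_n$ is an entry $\pi_i$ with $\pi_i<\pi_j$ for all $j>i$. -}

module Defs where

open import Data.Bool using (Bool; true; false; _∧_; if_then_else_)
open import Data.Nat using (ℕ; zero; suc; _+_; _*_; _<ᵇ_; _≡ᵇ_)
open import Data.List using (List; []; _∷_; map; concatMap; length; filterᵇ; upTo)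

allᵇ : (ℕ → Bool) → List ℕ → Bool
allᵇ p [] = true
allᵇ p (x ∷ xs) = p x ∧ allᵇ p xs

[_] : ℕ → List ℕ
[ n ] = map suc (upTo n)

words : ℕ → List ℕ → List (List ℕ)
words zero    A = [] ∷ []
words (suc k) A = concatMap (λ a → map (a ∷_) (words k A)) A

distinct : List ℕ → Bool
distinct []       = true
distinct (x ∷ xs) = allᵇ (λ y → Data.Bool.not (x ≡ᵇ y)) xs ∧ distinct xs

perms : ℕ → List (List ℕ)
perms n = filterᵇ distinct (words n [ n ])

runs : List ℕ → List (List ℕ)
runs [] = []
runs (x ∷ xs) with runs xs
... | [] = (x ∷ []) ∷ []
... | [] ∷ rs = (x ∷ []) ∷ [] ∷ rs
... | (y ∷ r) ∷ rs = if x <ᵇ y then (x ∷ y ∷ r) ∷ rs else (x ∷ []) ∷ (y ∷ r) ∷ rs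

-- minimum of a run = its first entry (runs are increasing); 0 for an empty list
runMin : List ℕ → ℕ
runMin [] = 0
runMin (x ∷ _) = x

increasing : List ℕ → Bool
increasing [] = true
increasing (x ∷ []) = true
increasing (x ∷ y ∷ ys) = (x <ᵇ y) ∧ increasing (y ∷ ys)

runSorted : List ℕ → Bool
runSorted π = increasing (map runMin (runs π))

rlMinCount : List ℕ → ℕ
rlMinCount [] = 0
rlMinCount (x ∷ xs) = (if allᵇ (x <ᵇ_) xs then 1 else 0) + rlMinCount xs

h : ℕ → ℕ → ℕ
h n r = length (filterᵇ (λ π → runSorted π ∧ (rlMinCount π ≡ᵇ r)) (perms n))

S : ℕ → ℕ → ℕ
S zero    zero    = 1
S zero    (suc k) = 0
S (suc n) zero    = 0
S (suc n) (suc k) = suc k * S n (suc k) + S n k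

{-# OPTIONS --safe #-}
-- Every permutation of [n+1] arises from exactly one permutation σ of [n] by
-- inserting n+1. A permutation is run-sorted iff each of its run starts, the
-- first entry included, is a right-to-left minimum. Hence inserting n+1 in
-- front of σ never gives a run-sorted permutation, the result is run-sorted
-- only if σ is, and for run-sorted σ with k right-to-left minima the good
-- insertions are: at the end, adding a right-to-left minimum, and just before
-- one of the k - 1 right-to-left minima after the first entry, keeping k.
-- So h(n+1, k+1) = h(n, k) + k h(n, k+1), the recurrence of S(n, k).
module Submission where

open import Defs
open import Function using (_∘_)
open import Function.Bundles using (Equivalence; mk⇔)
open import Data.Bool using (Bool; true; false; not; _∧_; _∨_; if_then_else_; T)
open import Data.Bool.Properties using (∧-zeroʳ; ∨-zeroʳ; T-≡; T-∧)
open import Data.Nat using (ℕ; zero; suc; _+_; _*_; _∸_; _<ᵇ_; _≡ᵇ_; _≤_; _<_; s≤s; z≤n; _≟_)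
open import Data.Nat.Properties
open import Data.Nat.Tactic.RingSolver using (solve-∀)
open import Data.List using (List; []; _∷_; map; length; filter; filterᵇ; concatMap; upTo; _++_)
open import Data.List.Properties using (length-map; length-upTo; length-removeAt′; ∷-injective; filter-accept; filter-reject; filter-all)
open import Data.List.Membership.Propositional using (_∈_; _∉_; lose; find)
open import Data.List.Membership.Propositional.Properties
open import Data.List.Membership.Propositional.Properties.WithK using (unique∧set⇒bag)
open import Data.List.Membership.DecPropositional _≟_ using (_∈?_)
open import Data.List.Relation.Unary.Any using (here; there; index; _─_)
open import Data.List.Relation.Unary.All as All using (All; []; _∷_)
open import Data.List.Relation.Unary.All.Properties using (¬Any⇒All¬; All¬⇒¬Any)
open import Data.List.Relation.Unary.AllPairs using ([]; _∷_)
open import Data.List.Relation.Unary.Unique.Propositional using (Unique)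
import Data.List.Relation.Unary.Unique.Propositional.Properties as Unique
open import Data.List.Relation.Binary.BagAndSetEquality using (∼bag⇒↭)
open import Data.List.Relation.Binary.Permutation.Propositional using (_↭_; ↭-refl; ↭-prep; ↭-swap; ↭-trans; ↭-sym; ↭⇒↭ₛ)
open import Data.List.Relation.Binary.Permutation.Propositional.Properties using (↭-length; filter-↭; All-resp-↭)
import Relation.Binary.PropositionalEquality as ≡
open import Data.List.Relation.Binary.Permutation.Setoid.Properties (≡.setoid ℕ) using (Unique-resp-↭)
open import Data.Product using (∃₂; _×_; _,_; proj₁; proj₂)
open import Data.Empty using (⊥-elim)
open import Relation.Nullary using (¬_; yes; no; ¬?)
open import Relation.Nullary.Decidable using (T?)
open import Relation.Binary.Definitions using (DecidableEquality)
open import Relation.Binary.PropositionalEquality hiding ([_])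
open ≡-Reasoning

𝟙 : Bool → ℕ
𝟙 b = if b then 1 else 0

module _ {A : Set} where

  count : (A → Bool) → List A → ℕ
  count P []       = 0
  count P (x ∷ xs) = 𝟙 (P x) + count P xs

  length-filterᵇ : ∀ P xs → length (filterᵇ P xs) ≡ count P xs
  length-filterᵇ P [] = refl
  length-filterᵇ P (x ∷ xs) with P x
  ... | true  = cong suc (length-filterᵇ P xs)
  ... | false = length-filterᵇ P xs

  count-cong : ∀ {P Q} xs → (∀ {x} → x ∈ xs → P x ≡ Q x) → count P xs ≡ count Q xs
  count-cong []       _   = refl
  count-cong (x ∷ xs) P≡Q = cong₂ _+_ (cong 𝟙 (P≡Q (here refl))) (count-cong xs (P≡Q ∘ there))

  count-none : ∀ {P} xs → (∀ {x} → x ∈ xs → P x ≡ false) → count P xs ≡ 0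
  count-none []       _        = refl
  count-none (x ∷ xs) P≡false rewrite P≡false (here refl) = count-none xs (P≡false ∘ there)

  count-++ : ∀ P xs ys → count P (xs ++ ys) ≡ count P xs + count P ys
  count-++ P []       ys = refl
  count-++ P (x ∷ xs) ys = trans (cong (𝟙 (P x) +_) (count-++ P xs ys)) (sym (+-assoc (𝟙 (P x)) _ _))

  count-↭ : ∀ P {xs ys} → xs ↭ ys → count P xs ≡ count P ys
  count-↭ P {xs} {ys} xs↭ys = begin
    count P xs               ≡⟨ length-filterᵇ P xs ⟨
    length (filterᵇ P xs)    ≡⟨ ↭-length (filter-↭ (T? ∘ P) xs↭ys) ⟩
    length (filterᵇ P ys)    ≡⟨ length-filterᵇ P ys ⟩
    count P ys               ∎

module _ {A B : Set} where

  count-map : ∀ P (f : B → A) xs → count P (map f xs) ≡ count (P ∘ f) xs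
  count-map P f []       = refl
  count-map P f (x ∷ xs) = cong (𝟙 (P (f x)) +_) (count-map P f xs)

  count-concatMap : ∀ P (f : B → List A) {Q R : B → Bool} k xs →
                    (∀ {x} → x ∈ xs → count P (f x) ≡ 𝟙 (Q x) + 𝟙 (R x) * k) →
                    count P (concatMap f xs) ≡ count Q xs + count R xs * k
  count-concatMap P f         k []       _     = refl
  count-concatMap P f {Q} {R} k (x ∷ xs) count≡ = begin
    count P (f x ++ concatMap f xs)
      ≡⟨ count-++ P (f x) (concatMap f xs) ⟩
    count P (f x) + count P (concatMap f xs)
      ≡⟨ cong₂ _+_ (count≡ (here refl)) (count-concatMap P f k xs (count≡ ∘ there)) ⟩
    (𝟙 (Q x) + 𝟙 (R x) * k) + (count Q xs + count R xs * k)
      ≡⟨ regroup (𝟙 (Q x)) (𝟙 (R x)) (count Q xs) (count R xs) k ⟩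
    (𝟙 (Q x) + count Q xs) + (𝟙 (R x) + count R xs) * k
      ∎
    where
    regroup : ∀ a b c d k → (a + b * k) + (c + d * k) ≡ (a + c) + (b + d) * k
    regroup = solve-∀

𝟙[m≡ᵇn]*m≡𝟙[m≡ᵇn]*n : ∀ m n → 𝟙 (m ≡ᵇ n) * m ≡ 𝟙 (m ≡ᵇ n) * n
𝟙[m≡ᵇn]*m≡𝟙[m≡ᵇn]*n m n with m ≡ᵇ n in eq
... | false = refl
... | true  = cong (1 *_) (≡ᵇ⇒≡ m n (Equivalence.from T-≡ eq))

<ᵇ≡true⇒< : ∀ m n → (m <ᵇ n) ≡ true → m < n
<ᵇ≡true⇒< m n eq = <ᵇ⇒< m n (Equivalence.from T-≡ eq)

<⇒<ᵇ≡true : ∀ {m n} → m < n → (m <ᵇ n) ≡ true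
<⇒<ᵇ≡true m<n = Equivalence.to T-≡ (<⇒<ᵇ m<n)

≤⇒<ᵇ≡false : ∀ {m n} → n ≤ m → (m <ᵇ n) ≡ false
≤⇒<ᵇ≡false {m} {n} n≤m with m <ᵇ n in eq
... | false = refl
... | true  = ⊥-elim (<⇒≱ (<ᵇ≡true⇒< m n eq) n≤m)

module _ {A : Set} where

  ∈-─ : ∀ {x z} {ys : List A} (x∈ys : x ∈ ys) → z ∈ ys → z ≢ x → z ∈ (ys ─ x∈ys)
  ∈-─ (here refl) (here refl) z≢x = ⊥-elim (z≢x refl)
  ∈-─ (here refl) (there z∈)  _   = z∈
  ∈-─ (there _)   (here refl) _   = here refl
  ∈-─ (there x∈)  (there z∈)  z≢x = there (∈-─ x∈ z∈ z≢x)

  Unique-⊆⇒length≤ : ∀ {xs ys : List A} → Unique xs → (∀ {z} → z ∈ xs → z ∈ ys) → length xs ≤ length ys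
  Unique-⊆⇒length≤ {[]}     _           _     = z≤n
  Unique-⊆⇒length≤ {x ∷ xs} {ys} (x∉xs ∷ u) xs⊆ys =
    ≤-trans (s≤s (Unique-⊆⇒length≤ u xs⊆ys─x)) (≤-reflexive (sym (length-removeAt′ ys (index x∈ys))))
    where
    x∈ys : x ∈ ys
    x∈ys = xs⊆ys (here refl)
    xs⊆ys─x : ∀ {z} → z ∈ xs → z ∈ (ys ─ x∈ys)
    xs⊆ys─x z∈ = ∈-─ x∈ys (xs⊆ys (there z∈)) (λ z≡x → All.lookup x∉xs z∈ (sym z≡x))

  Unique-∷⁻ : ∀ {x} {xs : List A} → Unique (x ∷ xs) → x ∉ xs × Unique xs
  Unique-∷⁻ (x≢xs ∷ u) = All¬⇒¬Any x≢xs , u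

  Unique-∷⁺ : ∀ {x} {xs : List A} → x ∉ xs → Unique xs → Unique (x ∷ xs)
  Unique-∷⁺ {xs = xs} x∉xs u = ¬Any⇒All¬ xs x∉xs ∷ u

module _ {B C : Set} where

  Unique-concatMap⁺ : ∀ (f : B → List C) {xs} → Unique xs → (∀ {x} → x ∈ xs → Unique (f x)) →
    (∀ {x y z} → x ∈ xs → y ∈ xs → z ∈ f x → z ∈ f y → x ≡ y) → Unique (concatMap f xs)
  Unique-concatMap⁺ f {[]}     _            _        _        = []
  Unique-concatMap⁺ f {x ∷ xs} (x∉xs ∷ u) unique-f disjoint-f =
    Unique.++⁺ (unique-f (here refl))
               (Unique-concatMap⁺ f u (unique-f ∘ there) (λ x∈ y∈ → disjoint-f (there x∈) (there y∈)))
               disjoint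
    where
    disjoint : ∀ {z} → ¬ (z ∈ f x × z ∈ concatMap f xs)
    disjoint (z∈fx , z∈rest) with y , y∈ , z∈fy ← find (∈-concatMap⁻ f {xs = xs} z∈rest) =
      All.lookup x∉xs y∈ (disjoint-f (here refl) (there y∈) z∈fx z∈fy)

insertions : {A : Set} → A → List A → List (List A)
insertions a []       = (a ∷ []) ∷ []
insertions a (x ∷ xs) = (a ∷ x ∷ xs) ∷ map (x ∷_) (insertions a xs)

module _ {A : Set} where

  insertions-↭ : ∀ {a π} (σ : List A) → π ∈ insertions a σ → π ↭ a ∷ σ
  insertions-↭ []       (here refl) = ↭-refl
  insertions-↭ (y ∷ ys) (here refl) = ↭-refl
  insertions-↭ {a} (y ∷ ys) (there π∈) with π′ , π′∈ , refl ← ∈-map⁻ (y ∷_) π∈ =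
    ↭-trans (↭-prep y (insertions-↭ ys π′∈)) (↭-swap y a ↭-refl)

  ∈-insertions-─ : ∀ {a} {π : List A} (a∈π : a ∈ π) → π ∈ insertions a (π ─ a∈π)
  ∈-insertions-─ {π = _ ∷ []}    (here refl) = here refl
  ∈-insertions-─ {π = _ ∷ _ ∷ _} (here refl) = here refl
  ∈-insertions-─ {π = y ∷ _}     (there a∈π) = there (∈-map⁺ (y ∷_) (∈-insertions-─ a∈π))

  Unique-insertions : ∀ {a} (σ : List A) → a ∉ σ → Unique (insertions a σ)
  Unique-insertions []       _   = [] ∷ []
  Unique-insertions {a} (y ∷ ys) a∉σ =
    All.tabulate front≢ ∷ Unique.map⁺ (proj₂ ∘ ∷-injective) (Unique-insertions ys (a∉σ ∘ there))
    where
    front≢ : ∀ {π} → π ∈ map (y ∷_) (insertions a ys) → a ∷ y ∷ ys ≢ π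
    front≢ π∈ eq with _ , _ , refl ← ∈-map⁻ (y ∷_) π∈ = a∉σ (here (proj₁ (∷-injective eq)))

  module _ (_≟ᴬ_ : DecidableEquality A) where

    remove : A → List A → List A
    remove a = filter (λ x → ¬? (a ≟ᴬ x))

    remove-insertions : ∀ {a π} σ → a ∉ σ → π ∈ insertions a σ → remove a π ≡ σ
    remove-insertions {a} [] _ (here refl) = filter-reject (λ x → ¬? (a ≟ᴬ x)) (λ a≢a → a≢a refl)
    remove-insertions {a} (y ∷ ys) a∉σ (here refl) = begin
      remove a (a ∷ y ∷ ys) ≡⟨ filter-reject (λ x → ¬? (a ≟ᴬ x)) (λ a≢a → a≢a refl) ⟩
      remove a (y ∷ ys)     ≡⟨ filter-all (λ x → ¬? (a ≟ᴬ x)) (¬Any⇒All¬ (y ∷ ys) a∉σ) ⟩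
      y ∷ ys                ∎
    remove-insertions {a} (y ∷ ys) a∉σ (there π∈) with π′ , π′∈ , refl ← ∈-map⁻ (y ∷_) π∈ =
      trans (filter-accept (λ x → ¬? (a ≟ᴬ x)) (a∉σ ∘ here))
            (cong (y ∷_) (remove-insertions ys (a∉σ ∘ there) π′∈))

rlMin : ℕ → List ℕ → Bool
rlMin x xs = allᵇ (x <ᵇ_) xs

<-rlMin-trans : ∀ {m y} ys → m < y → rlMin y ys ≡ true → rlMin m ys ≡ true
<-rlMin-trans []       m<y _ = refl
<-rlMin-trans {m} {y} (z ∷ zs) m<y yMin with y <ᵇ z in y<z
... | true rewrite <⇒<ᵇ≡true (<-trans m<y (<ᵇ≡true⇒< y z y<z)) = <-rlMin-trans zs m<y yMin

-- runStartsRLMin p xs: every entry of xs that starts a run of p ∷ xs is a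
-- right-to-left minimum.
runStartsRLMin : ℕ → List ℕ → Bool
runStartsRLMin p []       = true
runStartsRLMin p (x ∷ xs) = ((p <ᵇ x) ∨ rlMin x xs) ∧ runStartsRLMin x xs

-- increasingRunMinimaAfter m x xs: reading x ∷ xs, where x lies in a run of
-- minimum m, the runs that start inside xs have increasing minima, all above m.
increasingRunMinimaAfter : ℕ → ℕ → List ℕ → Bool
increasingRunMinimaAfter m x []       = true
increasingRunMinimaAfter m x (y ∷ ys) =
  if x <ᵇ y then increasingRunMinimaAfter m y ys
            else (m <ᵇ y) ∧ increasingRunMinimaAfter y y ys

runs-∷ : ∀ x xs → ∃₂ λ r rs → runs (x ∷ xs) ≡ (x ∷ r) ∷ rs
                   × (∀ m → increasing (m ∷ map runMin rs) ≡ increasingRunMinimaAfter m x xs)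
runs-∷ x []       = [] , [] , refl , λ _ → refl
runs-∷ x (y ∷ ys) with runs-∷ y ys
... | r , rs , runs≡ , minima rewrite runs≡ with x <ᵇ y
...   | true  = y ∷ r , rs , refl , minima
...   | false = [] , (y ∷ r) ∷ rs , refl , λ m → cong ((m <ᵇ y) ∧_) (minima y)

runSorted≡increasingRunMinimaAfter : ∀ x xs → runSorted (x ∷ xs) ≡ increasingRunMinimaAfter x x xs
runSorted≡increasingRunMinimaAfter x xs with runs-∷ x xs
... | r , rs , runs≡ , minima rewrite runs≡ = minima x

increasingRunMinimaAfter≡ : ∀ {m x} xs → m ≤ x →
                            increasingRunMinimaAfter m x xs ≡ rlMin m xs ∧ runStartsRLMin x xs
increasingRunMinimaAfter≡ []       m≤x = refl
increasingRunMinimaAfter≡ {m} {x} (y ∷ ys) m≤x with x <ᵇ y in x<y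
... | true rewrite <⇒<ᵇ≡true (≤-<-trans m≤x (<ᵇ≡true⇒< x y x<y)) =
  increasingRunMinimaAfter≡ ys (<⇒≤ (≤-<-trans m≤x (<ᵇ≡true⇒< x y x<y)))
... | false rewrite increasingRunMinimaAfter≡ ys (≤-refl {y}) with m <ᵇ y in m<y
...   | false = refl
...   | true with rlMin y ys in yMin
...     | false = sym (∧-zeroʳ (rlMin m ys))
...     | true rewrite <-rlMin-trans ys (<ᵇ≡true⇒< m y m<y) yMin = refl

runSorted-∷ : ∀ x xs → runSorted (x ∷ xs) ≡ rlMin x xs ∧ runStartsRLMin x xs
runSorted-∷ x xs = trans (runSorted≡increasingRunMinimaAfter x xs) (increasingRunMinimaAfter≡ xs ≤-refl)

-- Inserting a maximum into a run-sorted permutation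
allᵇ-insertions : ∀ f {a π} σ → π ∈ insertions a σ → allᵇ f π ≡ f a ∧ allᵇ f σ
allᵇ-insertions f []       (here refl) = refl
allᵇ-insertions f (y ∷ ys) (here refl) = refl
allᵇ-insertions f {a} (y ∷ ys) (there π∈) with π′ , π′∈ , refl ← ∈-map⁻ (y ∷_) π∈
  rewrite allᵇ-insertions f ys π′∈ with f y
... | true  = refl
... | false = sym (∧-zeroʳ (f a))

rlMin-insertions : ∀ {y a π} ys → y < a → π ∈ insertions a ys → rlMin y π ≡ rlMin y ys
rlMin-insertions {y} ys y<a π∈ =
  trans (allᵇ-insertions (y <ᵇ_) ys π∈) (cong (_∧ rlMin y ys) (<⇒<ᵇ≡true y<a))

count-insertions-cases : ∀ B R Rs (f : ℕ → Bool) k →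
  𝟙 ((R ∧ Rs) ∧ f (𝟙 R + k))
    + (if B ∨ R then (if Rs then 𝟙 (f (𝟙 R + suc k)) + 𝟙 (f (𝟙 R + k)) * k else 0) else 0)
  ≡ (if (B ∨ R) ∧ Rs then 𝟙 (f (suc (𝟙 R + k))) + 𝟙 (f (𝟙 R + k)) * (𝟙 R + k) else 0)
count-insertions-cases false false Rs    f k = refl
count-insertions-cases true  false Rs    f k = refl
count-insertions-cases B     true  false f k rewrite ∨-zeroʳ B = refl
count-insertions-cases B     true  true  f k rewrite ∨-zeroʳ B = regroup (𝟙 (f (suc (suc k)))) (𝟙 (f (suc k))) k
  where
  regroup : ∀ a b k → b + (a + b * k) ≡ a + b * suc k
  regroup = solve-∀

-- The predicate f on the number of right-to-left minima is generalised so
-- that the induction can shift it past the head of σ.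
count-insertions : ∀ (f : ℕ → Bool) {a p} σ → p < a → All (_< a) σ →
  count (λ π → runStartsRLMin p π ∧ f (rlMinCount π)) (insertions a σ)
  ≡ (if runStartsRLMin p σ
       then 𝟙 (f (suc (rlMinCount σ))) + 𝟙 (f (rlMinCount σ)) * rlMinCount σ
       else 0)
count-insertions f [] p<a [] rewrite <⇒<ᵇ≡true p<a | *-zeroʳ (𝟙 (f 0)) = refl
count-insertions f {a} {p} (y ∷ ys) p<a (y<a ∷ ys<a) = begin
  𝟙 (P (a ∷ y ∷ ys)) + count P (map (y ∷_) (insertions a ys))
    ≡⟨ cong₂ _+_ atFront (count-map P (y ∷_) (insertions a ys)) ⟩
  𝟙 ((R ∧ Rs) ∧ f (𝟙 R + k)) + count (P ∘ (y ∷_)) (insertions a ys)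
    ≡⟨ cong (𝟙 ((R ∧ Rs) ∧ f (𝟙 R + k)) +_) (trans (count-cong (insertions a ys) afterHead) countAfterHead) ⟩
  𝟙 ((R ∧ Rs) ∧ f (𝟙 R + k))
    + (if B ∨ R then (if Rs then 𝟙 (f (𝟙 R + suc k)) + 𝟙 (f (𝟙 R + k)) * k else 0) else 0)
    ≡⟨ count-insertions-cases B R Rs f k ⟩
  (if (B ∨ R) ∧ Rs then 𝟙 (f (suc (𝟙 R + k))) + 𝟙 (f (𝟙 R + k)) * (𝟙 R + k) else 0)
    ∎
  where
  P : List ℕ → Bool
  P π = runStartsRLMin p π ∧ f (rlMinCount π)
  B R Rs : Bool
  B  = p <ᵇ y
  R  = rlMin y ys
  Rs = runStartsRLMin y ys
  k : ℕ
  k = rlMinCount ys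

  atFront : 𝟙 (P (a ∷ y ∷ ys)) ≡ 𝟙 ((R ∧ Rs) ∧ f (𝟙 R + k))
  atFront rewrite <⇒<ᵇ≡true p<a | ≤⇒<ᵇ≡false (<⇒≤ y<a) = refl

  afterHead : ∀ {π} → π ∈ insertions a ys →
            P (y ∷ π) ≡ ((B ∨ R) ∧ runStartsRLMin y π) ∧ f (𝟙 R + rlMinCount π)
  afterHead π∈ rewrite rlMin-insertions ys y<a π∈ = refl

  countAfterHead : count (λ π → ((B ∨ R) ∧ runStartsRLMin y π) ∧ f (𝟙 R + rlMinCount π)) (insertions a ys)
         ≡ (if B ∨ R then (if Rs then 𝟙 (f (𝟙 R + suc k)) + 𝟙 (f (𝟙 R + k)) * k else 0) else 0)
  countAfterHead with B ∨ R
  ... | false = count-none (insertions a ys) (λ _ → refl)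
  ... | true  = count-insertions (f ∘ (𝟙 R +_)) ys y<a ys<a

runSortedWith : ℕ → List ℕ → Bool
runSortedWith r π = runSorted π ∧ (rlMinCount π ≡ᵇ r)

count-insertions-runSortedWith : ∀ k {a} x xs → All (_< a) (x ∷ xs) →
  count (runSortedWith (suc k)) (insertions a (x ∷ xs))
  ≡ 𝟙 (runSortedWith k (x ∷ xs)) + 𝟙 (runSortedWith (suc k) (x ∷ xs)) * k
count-insertions-runSortedWith k {a} x xs (x<a ∷ xs<a) = begin
  𝟙 (runSortedWith (suc k) (a ∷ x ∷ xs)) + count (runSortedWith (suc k)) (map (x ∷_) (insertions a xs))
    ≡⟨ cong₂ _+_ (cong 𝟙 atFront) (count-map (runSortedWith (suc k)) (x ∷_) (insertions a xs)) ⟩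
  count (runSortedWith (suc k) ∘ (x ∷_)) (insertions a xs)
    ≡⟨ count-cong (insertions a xs) afterHead ⟩
  count (λ π → (R ∧ runStartsRLMin x π) ∧ (𝟙 R + rlMinCount π ≡ᵇ suc k)) (insertions a xs)
    ≡⟨ countAfterHead ⟩
  𝟙 ((R ∧ Rs) ∧ (𝟙 R + c ≡ᵇ k)) + 𝟙 ((R ∧ Rs) ∧ (𝟙 R + c ≡ᵇ suc k)) * k
    ≡⟨ cong₂ (λ u v → 𝟙 (u ∧ (𝟙 R + c ≡ᵇ k)) + 𝟙 (v ∧ (𝟙 R + c ≡ᵇ suc k)) * k)
             (runSorted-∷ x xs) (runSorted-∷ x xs) ⟨
  𝟙 (runSortedWith k (x ∷ xs)) + 𝟙 (runSortedWith (suc k) (x ∷ xs)) * k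
    ∎
  where
  R Rs : Bool
  R  = rlMin x xs
  Rs = runStartsRLMin x xs
  c : ℕ
  c = rlMinCount xs

  atFront : runSortedWith (suc k) (a ∷ x ∷ xs) ≡ false
  atFront rewrite runSorted-∷ a (x ∷ xs) | ≤⇒<ᵇ≡false (<⇒≤ x<a) = refl

  afterHead : ∀ {π} → π ∈ insertions a xs →
            runSortedWith (suc k) (x ∷ π) ≡ (R ∧ runStartsRLMin x π) ∧ (𝟙 R + rlMinCount π ≡ᵇ suc k)
  afterHead {π} π∈ rewrite runSorted-∷ x π | rlMin-insertions xs x<a π∈ = refl

  countAfterHead : count (λ π → (R ∧ runStartsRLMin x π) ∧ (𝟙 R + rlMinCount π ≡ᵇ suc k)) (insertions a xs)
        ≡ 𝟙 ((R ∧ Rs) ∧ (𝟙 R + c ≡ᵇ k)) + 𝟙 ((R ∧ Rs) ∧ (𝟙 R + c ≡ᵇ suc k)) * k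
  countAfterHead with rlMin x xs
  ... | false = count-none (insertions a xs) (λ _ → refl)
  ... | true  = trans (count-insertions (_≡ᵇ k) xs x<a xs<a) countFromRLMins
    where
    countFromRLMins : (if Rs then 𝟙 (suc c ≡ᵇ k) + 𝟙 (c ≡ᵇ k) * c else 0)
           ≡ 𝟙 (Rs ∧ (suc c ≡ᵇ k)) + 𝟙 (Rs ∧ (c ≡ᵇ k)) * k
    countFromRLMins with Rs
    ... | false = refl
    ... | true  = cong (𝟙 (suc c ≡ᵇ k) +_) (𝟙[m≡ᵇn]*m≡𝟙[m≡ᵇn]*n c k)

-- Permutations of [n + 1] as insertions of n + 1
∈-words⁻ : ∀ k A {w} → w ∈ words k A → length w ≡ k × All (_∈ A) w
∈-words⁻ zero    A (here refl) = refl , []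
∈-words⁻ (suc k) A w∈
  with a , a∈ , w∈a ← find (∈-concatMap⁻ (λ a → map (a ∷_) (words k A)) {xs = A} w∈)
  with w′ , w′∈ , refl ← ∈-map⁻ (a ∷_) w∈a
  with length≡ , all∈ ← ∈-words⁻ k A w′∈ = cong suc length≡ , a∈ ∷ all∈

∈-words⁺ : ∀ k A {w} → length w ≡ k → All (_∈ A) w → w ∈ words k A
∈-words⁺ zero    A {[]}    _       []         = here refl
∈-words⁺ (suc k) A {a ∷ w} length≡ (a∈ ∷ all∈) =
  ∈-concatMap⁺ (λ a → map (a ∷_) (words k A)) {xs = A}
    (lose a∈ (∈-map⁺ (a ∷_) (∈-words⁺ k A (suc-injective length≡) all∈)))

words-Unique : ∀ k {A} → Unique A → Unique (words k A)
words-Unique zero    _ = [] ∷ []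
words-Unique (suc k) {A} u = Unique-concatMap⁺ (λ a → map (a ∷_) (words k A)) u
  (λ _ → Unique.map⁺ (proj₂ ∘ ∷-injective) (words-Unique k u))
  same-head
  where
  same-head : ∀ {a b w} → a ∈ A → b ∈ A → w ∈ map (a ∷_) (words k A) → w ∈ map (b ∷_) (words k A) → a ≡ b
  same-head _ _ w∈a w∈b with _ , _ , refl ← ∈-map⁻ _ w∈a | _ , _ , eq ← ∈-map⁻ _ w∈b = proj₁ (∷-injective eq)

distinct⇒Unique : ∀ xs → T (distinct xs) → Unique xs
distinct⇒Unique []       _ = []
distinct⇒Unique (x ∷ xs) t
  with head-fresh , tail-distinct ← Equivalence.to T-∧ t = fresh xs head-fresh ∷ distinct⇒Unique xs tail-distinct
  where
  fresh : ∀ ys → T (allᵇ (λ y → not (x ≡ᵇ y)) ys) → All (x ≢_) ys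
  fresh []       _ = []
  fresh (y ∷ ys) t with x ≡ᵇ y in x≡ᵇy
  ... | false = (λ x≡y → subst T x≡ᵇy (≡⇒≡ᵇ x y x≡y)) ∷ fresh ys t

Unique⇒distinct : ∀ xs → Unique xs → T (distinct xs)
Unique⇒distinct []       _          = _
Unique⇒distinct (x ∷ xs) (x≢xs ∷ u) = Equivalence.from T-∧ (fresh xs x≢xs , Unique⇒distinct xs u)
  where
  fresh : ∀ ys → All (x ≢_) ys → T (allᵇ (λ y → not (x ≡ᵇ y)) ys)
  fresh []       _            = _
  fresh (y ∷ ys) (x≢y ∷ x≢ys) with x ≡ᵇ y in x≡ᵇy
  ... | false = fresh ys x≢ys
  ... | true  = x≢y (≡ᵇ⇒≡ x y (Equivalence.from T-≡ x≡ᵇy))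

∈-[]⁻ : ∀ {n x} → x ∈ [ n ] → 1 ≤ x × x ≤ n
∈-[]⁻ x∈ with _ , i∈ , refl ← ∈-map⁻ suc x∈ = s≤s z≤n , ∈-upTo⁻ i∈

∈-[]⁺ : ∀ {n x} → 1 ≤ x → x ≤ n → x ∈ [ n ]
∈-[]⁺ {x = suc _} _ x≤n = ∈-map⁺ suc (∈-upTo⁺ x≤n)

∈[n]⇒<1+n : ∀ {n x} → x ∈ [ n ] → x < suc n
∈[n]⇒<1+n x∈ = s≤s (proj₂ (∈-[]⁻ x∈))

∈[n]⇒∈[1+n] : ∀ {n x} → x ∈ [ n ] → x ∈ [ suc n ]
∈[n]⇒∈[1+n] x∈ with 1≤x , x≤n ← ∈-[]⁻ x∈ = ∈-[]⁺ 1≤x (m≤n⇒m≤1+n x≤n)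

∈[1+n]⇒∈[n] : ∀ {n x} → x ∈ [ suc n ] → x ≢ suc n → x ∈ [ n ]
∈[1+n]⇒∈[n] x∈ x≢1+n with 1≤x , x≤1+n ← ∈-[]⁻ x∈ = ∈-[]⁺ 1≤x (m<1+n⇒m≤n (≤∧≢⇒< x≤1+n x≢1+n))

1+n∈[1+n] : ∀ n → suc n ∈ [ suc n ]
1+n∈[1+n] n = ∈-[]⁺ (s≤s z≤n) ≤-refl

1+n∉[n] : ∀ n → suc n ∉ [ n ]
1+n∉[n] n 1+n∈ = 1+n≰n (proj₂ (∈-[]⁻ 1+n∈))

[]-Unique : ∀ n → Unique [ n ]
[]-Unique n = Unique.map⁺ suc-injective (Unique.upTo⁺ n)

length-[] : ∀ n → length [ n ] ≡ n
length-[] n = trans (length-map suc (upTo n)) (length-upTo n)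

IsPermutation : ℕ → List ℕ → Set
IsPermutation n π = length π ≡ n × All (_∈ [ n ]) π × Unique π

∈-perms⁻ : ∀ n {π} → π ∈ perms n → IsPermutation n π
∈-perms⁻ n π∈ with π∈words , t ← ∈-filter⁻ (T? ∘ distinct) {xs = words n [ n ]} π∈
  with length≡ , all∈ ← ∈-words⁻ n [ n ] π∈words = length≡ , all∈ , distinct⇒Unique _ t

∈-perms⁺ : ∀ n {π} → IsPermutation n π → π ∈ perms n
∈-perms⁺ n (length≡ , all∈ , u) =
  ∈-filter⁺ (T? ∘ distinct) (∈-words⁺ n [ n ] length≡ all∈) (Unique⇒distinct _ u)

perms-Unique : ∀ n → Unique (perms n)
perms-Unique n = Unique.filter⁺ (T? ∘ distinct) (words-Unique n ([]-Unique n))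

IsPermutation-top⁻ : ∀ {n π σ} → π ↭ suc n ∷ σ → IsPermutation (suc n) π → IsPermutation n σ
IsPermutation-top⁻ {n} {π} {σ} π↭ (length≡ , all∈ , u)
  with _ ∷ σ⊆[1+n] ← All-resp-↭ π↭ all∈ | top∉σ , σ-Unique ← Unique-∷⁻ (Unique-resp-↭ (↭⇒↭ₛ π↭) u) =
  suc-injective (trans (sym (↭-length π↭)) length≡) , All.tabulate below-top , σ-Unique
  where
  below-top : ∀ {x} → x ∈ σ → x ∈ [ n ]
  below-top x∈ = ∈[1+n]⇒∈[n] (All.lookup σ⊆[1+n] x∈) (λ x≡1+n → top∉σ (subst (_∈ σ) x≡1+n x∈))

IsPermutation-top⁺ : ∀ {n π σ} → π ↭ suc n ∷ σ → IsPermutation n σ → IsPermutation (suc n) π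
IsPermutation-top⁺ {n} π↭ (length≡ , all∈ , u) =
  trans (↭-length π↭) (cong suc length≡) ,
  All-resp-↭ (↭-sym π↭) (1+n∈[1+n] n ∷ All.map ∈[n]⇒∈[1+n] all∈) ,
  Unique-resp-↭ (↭⇒↭ₛ (↭-sym π↭)) (Unique-∷⁺ (1+n∉[n] n ∘ All.lookup all∈) u)

-- Pigeonhole: without n + 1, the n + 1 distinct entries of π would lie in [n].
1+n∈perm : ∀ {n π} → IsPermutation (suc n) π → suc n ∈ π
1+n∈perm {n} {π} (length≡ , all∈ , u) with suc n ∈? π
... | yes 1+n∈π = 1+n∈π
... | no  1+n∉π = ⊥-elim (1+n≰n (subst₂ _≤_ length≡ (length-[] n) (Unique-⊆⇒length≤ u below-top)))
  where
  below-top : ∀ {x} → x ∈ π → x ∈ [ n ]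
  below-top x∈ = ∈[1+n]⇒∈[n] (All.lookup all∈ x∈) (λ x≡1+n → 1+n∉π (subst (_∈ π) x≡1+n x∈))

perms-suc⊆ : ∀ n {π} → π ∈ perms (suc n) → π ∈ concatMap (insertions (suc n)) (perms n)
perms-suc⊆ n {π} π∈ = ∈-concatMap⁺ (insertions (suc n)) {xs = perms n}
  (lose (∈-perms⁺ n (IsPermutation-top⁻ (insertions-↭ _ π∈insertions) π-IsPermutation)) π∈insertions)
  where
  π-IsPermutation : IsPermutation (suc n) π
  π-IsPermutation = ∈-perms⁻ (suc n) π∈
  π∈insertions : π ∈ insertions (suc n) (π ─ 1+n∈perm π-IsPermutation)
  π∈insertions = ∈-insertions-─ (1+n∈perm π-IsPermutation)

insertions-perms⊆ : ∀ n {π} → π ∈ concatMap (insertions (suc n)) (perms n) → π ∈ perms (suc n)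
insertions-perms⊆ n π∈ with σ , σ∈ , π∈ins ← find (∈-concatMap⁻ (insertions (suc n)) {xs = perms n} π∈) =
  ∈-perms⁺ (suc n) (IsPermutation-top⁺ (insertions-↭ σ π∈ins) (∈-perms⁻ n σ∈))

insertions-perms-Unique : ∀ n → Unique (concatMap (insertions (suc n)) (perms n))
insertions-perms-Unique n = Unique-concatMap⁺ (insertions (suc n)) (perms-Unique n)
  (λ σ∈ → Unique-insertions _ (1+n∉ σ∈))
  (λ σ∈ τ∈ π∈σ π∈τ → trans (sym (remove-insertions _≟_ _ (1+n∉ σ∈) π∈σ)) (remove-insertions _≟_ _ (1+n∉ τ∈) π∈τ))
  where
  1+n∉ : ∀ {σ} → σ ∈ perms n → suc n ∉ σ
  1+n∉ σ∈ = 1+n∉[n] n ∘ All.lookup (proj₁ (proj₂ (∈-perms⁻ n σ∈)))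

perms-suc-↭ : ∀ n → perms (suc n) ↭ concatMap (insertions (suc n)) (perms n)
perms-suc-↭ n = ∼bag⇒↭ (unique∧set⇒bag (perms-Unique (suc n)) (insertions-perms-Unique n)
                                      (mk⇔ (perms-suc⊆ n) (insertions-perms⊆ n)))

h≡count : ∀ n r → h n r ≡ count (runSortedWith r) (perms n)
h≡count n r = length-filterᵇ (runSortedWith r) (perms n)

h-recurrence : ∀ m k → h (suc (suc m)) (suc k) ≡ h (suc m) k + h (suc m) (suc k) * k
h-recurrence m k = begin
  h (suc (suc m)) (suc k)
    ≡⟨ h≡count (suc (suc m)) (suc k) ⟩
  count (runSortedWith (suc k)) (perms (suc (suc m)))
    ≡⟨ count-↭ (runSortedWith (suc k)) (perms-suc-↭ (suc m)) ⟩
  count (runSortedWith (suc k)) (concatMap (insertions (suc (suc m))) (perms (suc m)))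
    ≡⟨ count-concatMap (runSortedWith (suc k)) (insertions (suc (suc m))) k (perms (suc m)) count-insertions-perm ⟩
  count (runSortedWith k) (perms (suc m)) + count (runSortedWith (suc k)) (perms (suc m)) * k
    ≡⟨ cong₂ (λ u v → u + v * k) (h≡count (suc m) k) (h≡count (suc m) (suc k)) ⟨
  h (suc m) k + h (suc m) (suc k) * k
    ∎
  where
  count-insertions-perm : ∀ {σ} → σ ∈ perms (suc m) →
    count (runSortedWith (suc k)) (insertions (suc (suc m)) σ) ≡ 𝟙 (runSortedWith k σ) + 𝟙 (runSortedWith (suc k) σ) * k
  count-insertions-perm {σ} σ∈ with ∈-perms⁻ (suc m) σ∈
  count-insertions-perm {[]}     σ∈ | () , _
  count-insertions-perm {x ∷ xs} σ∈ | _ , all∈ , _ = count-insertions-runSortedWith k x xs (All.map ∈[n]⇒<1+n all∈)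

0<rlMinCount : ∀ x xs → 0 < rlMinCount (x ∷ xs)
0<rlMinCount x []       = s≤s z≤n
0<rlMinCount x (y ∷ ys) = ≤-trans (0<rlMinCount y ys) (m≤n+m _ (𝟙 (rlMin x (y ∷ ys))))

runSortedWith-zero : ∀ x xs → runSortedWith 0 (x ∷ xs) ≡ false
runSortedWith-zero x xs with rlMinCount (x ∷ xs) | 0<rlMinCount x xs
... | suc _ | _ = ∧-zeroʳ (runSorted (x ∷ xs))

h-zero : ∀ m → h (suc m) 0 ≡ 0
h-zero m = trans (h≡count (suc m) 0) (count-none (perms (suc m)) not-runSortedWith-zero)
  where
  not-runSortedWith-zero : ∀ {σ} → σ ∈ perms (suc m) → runSortedWith 0 σ ≡ false
  not-runSortedWith-zero {σ} σ∈ with ∈-perms⁻ (suc m) σ∈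
  not-runSortedWith-zero {[]}     σ∈ | () , _
  not-runSortedWith-zero {x ∷ xs} σ∈ | _      = runSortedWith-zero x xs

h≡S : ∀ m k → h (suc m) (suc k) ≡ S m k
h≡S zero    zero    = refl
h≡S zero    (suc k) = refl
h≡S (suc m) zero    = begin
  h (suc (suc m)) 1                 ≡⟨ h-recurrence m 0 ⟩
  h (suc m) 0 + h (suc m) 1 * 0     ≡⟨ cong₂ _+_ (h-zero m) (*-zeroʳ (h (suc m) 1)) ⟩
  0                                 ∎
h≡S (suc m) (suc k) = begin
  h (suc (suc m)) (suc (suc k))                         ≡⟨ h-recurrence m (suc k) ⟩
  h (suc m) (suc k) + h (suc m) (suc (suc k)) * suc k   ≡⟨ cong₂ (λ u v → u + v * suc k) (h≡S m k) (h≡S m (suc k)) ⟩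
  S m k + S m (suc k) * suc k                           ≡⟨ +-comm (S m k) _ ⟩
  S m (suc k) * suc k + S m k                           ≡⟨ cong (_+ S m k) (*-comm (S m (suc k)) (suc k)) ⟩
  suc k * S m (suc k) + S m k                           ∎

mainTheorem12 : (n r : ℕ) → 1 ≤ r → r ≤ n → h n r ≡ S (n ∸ 1) (r ∸ 1)
mainTheorem12 n       zero    ()
mainTheorem12 zero    (suc k) _ ()
mainTheorem12 (suc m) (suc k) _ _ = h≡S m k
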